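{- For every composition $\alpha$, the non-commutative affine Schur functions converge to the non-commutative Schur function as $k\to\infty$: there exists $K$ such that $S^{(k)}_\alpha=S_\alpha$ in $\mathsf{NSym}$ for all $k\ge K$.
   Context: Compositions: finite sequences of positive integers; $k$-bounded if all parts $\le k$; $\mathcal{C}^k$ the set of $k$-bounded compositions; $\lambda(\alpha)$ the partition obtained by sorting $\alpha$. $\mathsf{NSym}=\mathbb{Q}\langle H_1,H_2,\dots\rangle$ (free associative algebra), $\mathsf{NSym}_{(k)}=\mathbb{Q}\langle H_1,\dots,H_k\rangle\subset\mathsf{NSym}$. $k$-conjugation: for a $(k+1)$-core $\kappa$, $p(\kappa)$ is the partition whose $i$-th part is the number of cells in row $i$ of $\kappa$ with hook length $\le k$; $p$ is a bijection from $(k+1)$-cores to $k$-bounded partitions with inverse $c$; $\lambda^{\omega_k}=p(c(\lambda)')$. For $k$-bounded partitions $\mu\subseteq\lambda$, $\lambda/\mu$ is a horizontal $k$-strip if it is a horizontal strip and $\lambda^{\omega_k}/\mu^{\omega_k}$ is a vertical strip. Composition order $\le_{\mathcal{C}}$: generated by covers $\beta\lessdot\alpha$ when $\alpha=[1,\beta_1,\dots,\beta_m]$ or $\alpha$ is obtained from $\beta$ by increasing by $1$ the leftmost part of $\beta$ equal to $m$. For $\beta\le_{\mathcal{C}}\alpha$, place $\beta$ in the diagram of $\alpha$ (row $i$ = columns $1..\alpha_i$) with $\beta_j$ in row $\ell(\alpha)-\ell(\beta)+j$; $\alpha/\!/\beta$ is the set of remaining cells, of size $|\alpha|-|\beta|$.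 It is a horizontal composition strip if $\beta\le_{\mathcal{C}}\alpha$ and no two of its cells share a column; a horizontal $k$-composition strip if in addition $\lambda(\alpha)/\lambda(\beta)$ is a horizontal $k$-strip. $\{S_\alpha\}_{\alpha}$ (non-commutative Schur functions) is the family in $\mathsf{NSym}$ with $S_\emptyset=1$ and $H_iS_\alpha=\sum_\beta S_\beta$ for all $i\ge1$, summed over $\beta$ with $\beta/\!/\alpha$ a horizontal composition strip of size $i$. $\{S^{(k)}_\alpha\}_{\alpha\in\mathcal{C}^k}$ is the family in $\mathsf{NSym}_{(k)}$ with $S^{(k)}_\emptyset=1$ and $H_iS^{(k)}_\alpha=\sum_\beta S^{(k)}_\beta$ for $1\le i\le k$, summed over $\beta$ with $\beta/\!/\alpha$ a horizontal $k$-composition strip of size $i$. -}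

module Defs where

open import Data.Bool using (Bool; true; false; _∧_; _∨_; not; if_then_else_; T)
open import Data.Nat using (ℕ; zero; suc; _+_; _*_; _∸_; _≤_; _≤ᵇ_; _≡ᵇ_)
open import Data.List using (List; []; _∷_; _++_; map; concatMap; concat; length; foldr; replicate; zip; upTo)
open import Data.Nat.ListAction using (sum)
open import Data.List.Relation.Unary.All using (All)
open import Data.Product using (_×_; _,_)
open import Data.Rational using (ℚ; 0ℚ; 1ℚ) renaming (_+_ to _+ℚ_; _*_ to _*ℚ_)
open import Relation.Binary.PropositionalEquality using (_≡_)
open import Relation.Nullary using (¬_)

eqL : List ℕ → List ℕ → Bool
eqL [] [] = true
eqL [] (_ ∷ _) = false
eqL (_ ∷ _) [] = false
eqL (x ∷ xs) (y ∷ ys) = (x ≡ᵇ y) ∧ eqL xs ys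

memL : List ℕ → List (List ℕ) → Bool
memL a [] = false
memL a (b ∷ bs) = eqL a b ∨ memL a bs

filterB : {A : Set} → (A → Bool) → List A → List A
filterB p [] = []
filterB p (x ∷ xs) = if p x then x ∷ filterB p xs else filterB p xs

allB : {A : Set} → (A → Bool) → List A → Bool
allB p [] = true
allB p (x ∷ xs) = p x ∧ allB p xs

allUpTo : (ℕ → Bool) → ℕ → Bool
allUpTo f n = allB f (upTo n)

countB : {A : Set} → (A → Bool) → List A → ℕ
countB p xs = length (filterB p xs)

-- i-th entry (0-indexed), 0 if out of range
nth : List ℕ → ℕ → ℕ
nth [] _ = 0
nth (x ∷ xs) zero = x
nth (x ∷ xs) (suc i) = nth xs i

size : List ℕ → ℕ
size = sum

IsComposition : List ℕ → Set
IsComposition α = All (λ p → 1 ≤ p) α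

KBounded : ℕ → List ℕ → Set
KBounded k α = All (λ p → p ≤ k) α

kBoundedB : ℕ → List ℕ → Bool
kBoundedB k α = allB (λ p → p ≤ᵇ k) α

incHead : List ℕ → List (List ℕ)
incHead [] = []
incHead (x ∷ xs) = (suc x ∷ xs) ∷ []

comps : ℕ → List (List ℕ)
comps zero = [] ∷ []
comps (suc n) = concatMap (λ c → (1 ∷ c) ∷ incHead c) (comps n)

insertDesc : ℕ → List ℕ → List ℕ
insertDesc x [] = x ∷ []
insertDesc x (y ∷ ys) = if y ≤ᵇ x then x ∷ y ∷ ys else y ∷ insertDesc x ys

sortDesc : List ℕ → List ℕ
sortDesc = foldr insertDesc []

isPartitionB : List ℕ → Bool
isPartitionB [] = true
isPartitionB (x ∷ []) = 1 ≤ᵇ x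
isPartitionB (x ∷ y ∷ ys) = (y ≤ᵇ x) ∧ isPartitionB (y ∷ ys)

partitionsOf : ℕ → List (List ℕ)
partitionsOf n = filterB isPartitionB (comps n)

-- conjugate partition: j-th column length (j 0-indexed)
conj : List ℕ → List ℕ
conj κ = map (λ j → countB (λ r → suc j ≤ᵇ r) κ) (upTo (nth κ 0))

-- hook length of cell in row i, column j (both 0-indexed) of κ
hook : List ℕ → ℕ → ℕ → ℕ
hook κ i j = ((nth κ i ∸ j) + (nth (conj κ) j ∸ i)) ∸ 1

rowCount : ℕ → List ℕ → ℕ → ℕ
rowCount k κ i = countB (λ j → hook κ i j ≤ᵇ k) (upTo (nth κ i))

-- (k+1)-core: no hook length equal to k+1
isCoreB : ℕ → List ℕ → Bool
isCoreB k κ = allUpTo (λ i → allUpTo (λ j → not (hook κ i j ≡ᵇ suc k)) (nth κ i)) (length κ)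

pMap : ℕ → List ℕ → List ℕ
pMap k κ = filterB (λ x → 1 ≤ᵇ x) (map (rowCount k κ) (upTo (length κ)))

findB : {A : Set} → (A → Bool) → A → List A → A
findB p d [] = d
findB p d (x ∷ xs) = if p x then x else findB p d xs

-- c(λ) = p⁻¹(λ): the (k+1)-core κ with p(κ) = λ, searched among all
-- partitions of size ≤ (|λ|+1)² (the core c(λ) has first row ≤ |λ| and ℓ(λ) rows)
cMap : ℕ → List ℕ → List ℕ
cMap k λ' = findB (λ κ → isCoreB k κ ∧ eqL (pMap k κ) λ') []
                  (concatMap partitionsOf (upTo (suc (suc (size λ') * suc (size λ')))))

omegaK : ℕ → List ℕ → List ℕ
omegaK k λ' = pMap k (conj (cMap k λ'))

containedB : List ℕ → List ℕ → Bool
containedB μ λ' = (length μ ≤ᵇ length λ') ∧ allUpTo (λ i → nth μ i ≤ᵇ nth λ' i) (length μ)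

hStripB : List ℕ → List ℕ → Bool
hStripB λ' μ = containedB μ λ' ∧ allUpTo (λ i → nth λ' (suc i) ≤ᵇ nth μ i) (length λ')

vStripB : List ℕ → List ℕ → Bool
vStripB ρ ν = containedB ν ρ ∧ allUpTo (λ i → nth ρ i ≤ᵇ suc (nth ν i)) (length ρ)

hkStripB : ℕ → List ℕ → List ℕ → Bool
hkStripB k λ' μ = kBoundedB k λ' ∧ kBoundedB k μ ∧ hStripB λ' μ
                  ∧ vStripB (omegaK k λ') (omegaK k μ)

incLeftmost : ℕ → List ℕ → List ℕ
incLeftmost m [] = []
incLeftmost m (x ∷ xs) = if x ≡ᵇ m then suc x ∷ xs else x ∷ incLeftmost m xs

-- upper covers of β in the composition order
covers : List ℕ → List (List ℕ)
covers β = (1 ∷ β) ∷ map (λ m → incLeftmost m β) β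

reach : ℕ → List ℕ → List (List ℕ)
reach zero β = β ∷ []
reach (suc d) β = concatMap covers (reach d β)

leCB : List ℕ → List ℕ → Bool
leCB β α = (size β ≤ᵇ size α) ∧ memL α (reach (size α ∸ size β) β)

-- rows of α//β: row r contains the columns in the interval (b_r , a_r]
disjointI : ℕ × ℕ → ℕ × ℕ → Bool
disjointI (b₁ , a₁) (b₂ , a₂) = (a₁ ≤ᵇ b₁) ∨ (a₂ ≤ᵇ b₂) ∨ (a₁ ≤ᵇ b₂) ∨ (a₂ ≤ᵇ b₁)

pairwiseDisj : List (ℕ × ℕ) → Bool
pairwiseDisj [] = true
pairwiseDisj (x ∷ xs) = allB (disjointI x) xs ∧ pairwiseDisj xs

skewRows : List ℕ → List ℕ → List (ℕ × ℕ)
skewRows α β = zip (replicate (length α ∸ length β) 0 ++ β) α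

hcStripB : List ℕ → List ℕ → Bool
hcStripB α β = leCB β α ∧ pairwiseDisj (skewRows α β)

hkcStripB : ℕ → List ℕ → List ℕ → Bool
hkcStripB k α β = hcStripB α β ∧ hkStripB k (sortDesc α) (sortDesc β)

hcStrips : List ℕ → ℕ → List (List ℕ)
hcStrips α i = filterB (λ β → hcStripB β α) (comps (size α + i))

hkcStrips : ℕ → List ℕ → ℕ → List (List ℕ)
hkcStrips k α i = filterB (λ β → kBoundedB k β ∧ hkcStripB k β α) (comps (size α + i))

-- The free associative algebra ℚ⟨H₀,H₁,H₂,…⟩ as finite formal ℚ-linear
-- combinations of words; a word (l₁ … lₙ) stands for H_{l₁}⋯H_{lₙ}.
-- NSym is the subspace spanned by words with letters ≥ 1.

NSym : Set
NSym = List (ℚ × List ℕ)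

coeff : NSym → List ℕ → ℚ
coeff x w = foldr (λ { (q , v) acc → if eqL v w then q +ℚ acc else acc }) 0ℚ x

infix 4 _≈_
_≈_ : NSym → NSym → Set
x ≈ y = ∀ w → coeff x w ≡ coeff y w

infixl 7 _·_
_·_ : NSym → NSym → NSym
x · y = concatMap (λ { (p , v) → map (λ { (q , u) → (p *ℚ q , v ++ u) }) y }) x

oneN : NSym
oneN = (1ℚ , []) ∷ []

H : ℕ → NSym
H i = (1ℚ , i ∷ []) ∷ []

sumN : List NSym → NSym
sumN = concat

InNSym : NSym → Set
InNSym x = ∀ w → ¬ (coeff x w ≡ 0ℚ) → All (λ l → 1 ≤ l) w

InNSymK : ℕ → NSym → Set
InNSymK k x = ∀ w → ¬ (coeff x w ≡ 0ℚ) → All (λ l → 1 ≤ l × l ≤ k) w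

IsNCSchur : (List ℕ → NSym) → Set
IsNCSchur S =
  (∀ α → IsComposition α → InNSym (S α))
  × S [] ≈ oneN
  × (∀ α → IsComposition α → ∀ i → 1 ≤ i → H i · S α ≈ sumN (map S (hcStrips α i)))

IsNCAffineSchur : ℕ → (List ℕ → NSym) → Set
IsNCAffineSchur k S =
  (∀ α → IsComposition α → KBounded k α → InNSymK k (S α))
  × S [] ≈ oneN
  × (∀ α → IsComposition α → KBounded k α → ∀ i → 1 ≤ i → i ≤ k →
       H i · S α ≈ sumN (map S (hkcStrips k α i)))

-- For k ≥ 2|α| every shape of size at most |α| has all hook lengths ≤ k. Such a partition is its
-- own (k+1)-core with p(κ) = κ, so k-conjugation is ordinary conjugation, and a horizontal
-- composition strip β//t (whose columns interlace with those of t) is automatically a horizontal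
-- k-composition strip. Hence S and S⁽ᵏ⁾ obey the same Pieri rule H_g S_t = Σ S_β up to size |α|.
-- In that rule β = g t occurs, and every other β is shorter than g t or equally long with a
-- smaller first part; by induction on this order the rule determines S_(g t), so the two agree.

module Submission where

open import Defs
open import Data.Bool using (Bool; true; false; _∧_; _∨_; not; if_then_else_; T)
open import Data.Empty using (⊥-elim)
open import Data.Unit using (tt)
open import Data.Nat using (ℕ; zero; suc; _+_; _*_; _∸_; _≤_; _<_; _≥_; _≤ᵇ_; _≡ᵇ_; z≤n; s≤s)
open import Data.Nat.Properties
open import Data.Nat.Induction using (<-rec)
open import Algebra.Properties.CommutativeSemigroup +-commutativeSemigroup using (x∙yz≈y∙xz)
open import Data.List using (List; []; _∷_; _++_; map; concatMap; concat; length; foldr; replicate; zip; upTo; applyUpTo)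
open import Data.List.Properties using (length-++; length-map; length-upTo; map-upTo; map-cong; concatMap-++; map-∘; ≡-dec)
open import Data.List.Relation.Unary.All as All using (All; []; _∷_)
import Data.List.Relation.Unary.All.Properties as All
open import Data.List.Relation.Unary.Any using (here; there)
open import Data.List.Relation.Unary.Linked using (Linked; []; [-]; _∷_)
open import Data.List.Relation.Binary.Pointwise as Pointwise using (Pointwise; []; _∷_; Pointwise-length)
open import Data.List.Membership.Propositional using (_∈_; lose; find)
open import Data.List.Membership.Propositional.Properties using (∈-concatMap⁺; ∈-concatMap⁻; ∈-map⁻; ∈-applyUpTo⁻; ∈-upTo⁺; ∈-upTo⁻)
open import Data.Product using (_×_; _,_; proj₁; proj₂; ∃)
open import Data.Sum using (_⊎_; inj₁; inj₂)
open import Data.Rational using (ℚ; 0ℚ) renaming (_+_ to _+ℚ_; _<_ to _<ℚ_; _≤_ to _≤ℚ_)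
import Data.Rational.Properties as ℚ
open import Relation.Binary.Definitions using (DecidableEquality; tri<; tri≈; tri>)
open import Relation.Binary.PropositionalEquality
open import Relation.Nullary using (¬_; yes; no)

T-∧⁺ : ∀ {a b} → T a → T b → T (a ∧ b)
T-∧⁺ {true} _ t = t

T-∧⁻ˡ : ∀ a {b} → T (a ∧ b) → T a
T-∧⁻ˡ true _ = tt

T-∧⁻ʳ : ∀ a {b} → T (a ∧ b) → T b
T-∧⁻ʳ true t = t

T-∨⁻ : ∀ a {b} → T (a ∨ b) → T a ⊎ T b
T-∨⁻ true _ = inj₁ tt
T-∨⁻ false t = inj₂ t

T-∨⁺ˡ : ∀ {a} b → T a → T (a ∨ b)
T-∨⁺ˡ {true} _ _ = tt

T-∨⁺ʳ : ∀ a {b} → T b → T (a ∨ b)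
T-∨⁺ʳ true _ = tt
T-∨⁺ʳ false t = t

T⇒≡true : ∀ {b} → T b → b ≡ true
T⇒≡true {true} _ = refl

≡true⇒T : ∀ {b} → b ≡ true → T b
≡true⇒T refl = tt

¬T⇒≡false : ∀ {b} → ¬ T b → b ≡ false
¬T⇒≡false {true} ¬t = ⊥-elim (¬t tt)
¬T⇒≡false {false} _ = refl

∧-implied : ∀ a b → (T a → T b) → a ∧ b ≡ a
∧-implied true b a⇒b = T⇒≡true (a⇒b tt)
∧-implied false b _ = refl

≤ᵇ-refl : ∀ n → T (n ≤ᵇ n)
≤ᵇ-refl n = ≤⇒≤ᵇ (≤-refl {n})

≡ᵇ-refl : ∀ n → (n ≡ᵇ n) ≡ true
≡ᵇ-refl n = T⇒≡true (≡⇒≡ᵇ n n refl)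

≤ᵇ≡false⇒> : ∀ {m n} → (m ≤ᵇ n) ≡ false → n < m
≤ᵇ≡false⇒> e = ≰⇒> (λ m≤n → subst T e (≤⇒≤ᵇ m≤n))

eqL-refl : ∀ a → T (eqL a a)
eqL-refl [] = tt
eqL-refl (x ∷ a) = T-∧⁺ (≡⇒≡ᵇ x x refl) (eqL-refl a)

eqL⇒≡ : ∀ a b → T (eqL a b) → a ≡ b
eqL⇒≡ [] [] _ = refl
eqL⇒≡ (x ∷ a) (y ∷ b) t =
  cong₂ _∷_ (≡ᵇ⇒≡ x y (T-∧⁻ˡ (x ≡ᵇ y) t)) (eqL⇒≡ a b (T-∧⁻ʳ (x ≡ᵇ y) t))

∈⇒memL : ∀ a bs → a ∈ bs → T (memL a bs)
∈⇒memL a (b ∷ bs) (here refl) = T-∨⁺ˡ (memL a bs) (eqL-refl a)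
∈⇒memL a (b ∷ bs) (there p) = T-∨⁺ʳ (eqL a b) (∈⇒memL a bs p)

memL⇒∈ : ∀ a bs → T (memL a bs) → a ∈ bs
memL⇒∈ a (b ∷ bs) t with T-∨⁻ (eqL a b) t
... | inj₁ e = here (eqL⇒≡ a b e)
... | inj₂ e = there (memL⇒∈ a bs e)

module _ {A : Set} (p : A → Bool) where

  ∈-filterB⁺ : ∀ {x} xs → x ∈ xs → T (p x) → x ∈ filterB p xs
  ∈-filterB⁺ (y ∷ xs) (here refl) t rewrite T⇒≡true t = here refl
  ∈-filterB⁺ (y ∷ xs) (there m) t with p y
  ... | true = there (∈-filterB⁺ xs m t)
  ... | false = ∈-filterB⁺ xs m t

  ∈-filterB⁻ : ∀ {x} xs → x ∈ filterB p xs → x ∈ xs × T (p x)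
  ∈-filterB⁻ (y ∷ xs) m with p y in e
  ∈-filterB⁻ (y ∷ xs) (here refl) | true = here refl , ≡true⇒T e
  ∈-filterB⁻ (y ∷ xs) (there m) | true = let (m′ , t) = ∈-filterB⁻ xs m in there m′ , t
  ... | false = let (m′ , t) = ∈-filterB⁻ xs m in there m′ , t

  filterB-cong : ∀ (q : A → Bool) xs → (∀ x → x ∈ xs → p x ≡ q x) → filterB p xs ≡ filterB q xs
  filterB-cong q [] _ = refl
  filterB-cong q (x ∷ xs) h rewrite h x (here refl) with q x
  ... | true = cong (x ∷_) (filterB-cong q xs (λ y m → h y (there m)))
  ... | false = filterB-cong q xs (λ y m → h y (there m))

  allB⁺ : ∀ xs → All (λ x → T (p x)) xs → T (allB p xs)
  allB⁺ [] [] = tt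
  allB⁺ (x ∷ xs) (px ∷ pxs) = T-∧⁺ px (allB⁺ xs pxs)

  allB⁻ : ∀ xs {x} → T (allB p xs) → x ∈ xs → T (p x)
  allB⁻ (y ∷ xs) t (here refl) = T-∧⁻ˡ (p y) t
  allB⁻ (y ∷ xs) t (there m) = allB⁻ xs (T-∧⁻ʳ (p y) t) m

  filterB-all : ∀ xs → All (λ x → T (p x)) xs → filterB p xs ≡ xs
  filterB-all [] [] = refl
  filterB-all (x ∷ xs) (px ∷ pxs) rewrite T⇒≡true px = cong (x ∷_) (filterB-all xs pxs)

  findB-first : ∀ d xs ys l → l ∈ xs → T (p l) → (∀ y → y ∈ xs → T (p y) → y ≡ l) →
                findB p d (xs ++ ys) ≡ l
  findB-first d (x ∷ xs) ys l m t unique with p x in e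
  ... | true = unique x (here refl) (≡true⇒T e)
  findB-first d (x ∷ xs) ys l (here refl) t unique | false = ⊥-elim (subst T e t)
  findB-first d (x ∷ xs) ys l (there m) t unique | false =
    findB-first d xs ys l m t (λ y m′ → unique y (there m′))

indicator : Bool → ℕ
indicator true = 1
indicator false = 0

module _ {A : Set} (p : A → Bool) where

  countB-∷ : ∀ x xs → countB p (x ∷ xs) ≡ indicator (p x) + countB p xs
  countB-∷ x xs with p x
  ... | true = refl
  ... | false = refl

  countB-++ : ∀ xs ys → countB p (xs ++ ys) ≡ countB p xs + countB p ys
  countB-++ [] ys = refl
  countB-++ (x ∷ xs) ys rewrite countB-∷ x (xs ++ ys) | countB-∷ x xs | countB-++ xs ys =
    sym (+-assoc (indicator (p x)) _ _)

  countB-none : ∀ xs → (∀ y → y ∈ xs → ¬ T (p y)) → countB p xs ≡ 0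
  countB-none [] _ = refl
  countB-none (x ∷ xs) h rewrite countB-∷ x xs | ¬T⇒≡false (h x (here refl)) =
    countB-none xs (λ y m → h y (there m))

  countB-all : ∀ xs → All (λ y → T (p y)) xs → countB p xs ≡ length xs
  countB-all [] [] = refl
  countB-all (x ∷ xs) (t ∷ ts) rewrite countB-∷ x xs | T⇒≡true t = cong suc (countB-all xs ts)

  countB≤length : ∀ xs → countB p xs ≤ length xs
  countB≤length [] = z≤n
  countB≤length (x ∷ xs) rewrite countB-∷ x xs with p x
  ... | true = s≤s (countB≤length xs)
  ... | false = m≤n⇒m≤1+n (countB≤length xs)

-- count≥ c α is the length of column c of the diagram of λ(α)
count≥ : ℕ → List ℕ → ℕ
count≥ c = countB (λ r → c ≤ᵇ r)

count≥-∷ : ∀ c x xs → count≥ c (x ∷ xs) ≡ indicator (c ≤ᵇ x) + count≥ c xs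
count≥-∷ c = countB-∷ (λ r → c ≤ᵇ r)

count≥1≡length : ∀ α → IsComposition α → count≥ 1 α ≡ length α
count≥1≡length α cα = countB-all (λ r → 1 ≤ᵇ r) α (All.map ≤⇒≤ᵇ cα)

-- Compositions and horizontal composition strips

comps-sound : ∀ n α → α ∈ comps n → IsComposition α × size α ≡ n
comps-sound zero .[] (here refl) = [] , refl
comps-sound (suc n) α m with find (∈-concatMap⁻ (λ c → (1 ∷ c) ∷ incHead c) {comps n} m)
... | β , βm , here refl = let (cβ , sβ) = comps-sound n β βm in s≤s z≤n ∷ cβ , cong suc sβ
... | x ∷ β , βm , there (here refl) with comps-sound n (x ∷ β) βm
...   | _ ∷ cβ , sβ = s≤s z≤n ∷ cβ , cong suc sβ

comps-complete : ∀ α → IsComposition α → α ∈ comps (size α)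
comps-complete [] _ = here refl
comps-complete (suc x ∷ α) (_ ∷ cα) = growHead x
  where
  growHead : ∀ x → (suc x ∷ α) ∈ comps (suc x + size α)
  growHead zero = ∈-concatMap⁺ _ (lose (comps-complete α cα) (here refl))
  growHead (suc x) = ∈-concatMap⁺ _ (lose (growHead x) (there (here refl)))

-- β sits inside the diagram of α, aligned with the last ℓ(β) rows of α
_⊑_ : List ℕ → List ℕ → Set
β ⊑ α = ∃ λ p → ∃ λ a → α ≡ p ++ a × Pointwise _≤_ β a

Pointwise-++ˡ⁻ : ∀ p {a c} → Pointwise _≤_ (p ++ a) c → ∃ λ p′ → ∃ λ c′ → c ≡ p′ ++ c′ × Pointwise _≤_ a c′
Pointwise-++ˡ⁻ [] {c = c} r = [] , c , refl , r
Pointwise-++ˡ⁻ (x ∷ p) (_∷_ {y = y} _ r) with Pointwise-++ˡ⁻ p r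
... | p′ , c′ , refl , r′ = y ∷ p′ , c′ , refl , r′

incLeftmost-≤ : ∀ m α → Pointwise _≤_ α (incLeftmost m α)
incLeftmost-≤ m [] = []
incLeftmost-≤ m (x ∷ α) with x ≡ᵇ m
... | true = n≤1+n x ∷ Pointwise.refl ≤-refl
... | false = ≤-refl ∷ incLeftmost-≤ m α

⊑-covers : ∀ {β α γ} → β ⊑ α → γ ∈ covers α → β ⊑ γ
⊑-covers (p , a , refl , r) (here refl) = 1 ∷ p , a , refl , r
⊑-covers {α = α} (p , a , refl , r) (there γ∈) with ∈-map⁻ (λ m → incLeftmost m α) γ∈
... | m , _ , refl with Pointwise-++ˡ⁻ p (incLeftmost-≤ m (p ++ a))
... | p′ , c′ , e , r′ = p′ , c′ , e , Pointwise.transitive ≤-trans r r′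

⊑-reach : ∀ d β {α} → α ∈ reach d β → β ⊑ α
⊑-reach zero β (here refl) = [] , β , refl , Pointwise.refl ≤-refl
⊑-reach (suc d) β m with find (∈-concatMap⁻ covers {reach d β} m)
... | α , αm , γm = ⊑-covers (⊑-reach d β αm) γm

leCB⇒⊑ : ∀ β α → T (leCB β α) → β ⊑ α
leCB⇒⊑ β α t = ⊑-reach (size α ∸ size β) β (memL⇒∈ α _ (T-∧⁻ʳ (size β ≤ᵇ size α) t))

head-cover : ∀ g t → (suc g ∷ t) ∈ reach (suc g) t
head-cover zero t = here refl
head-cover (suc g) t = ∈-concatMap⁺ covers (lose (head-cover g t) grow)
  where
  grow : (suc (suc g) ∷ t) ∈ covers (suc g ∷ t)
  grow rewrite ≡ᵇ-refl g = there (here refl)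

-- the row (b , a) of a skew diagram occupies the columns b+1, …, a
inRow : ℕ → ℕ × ℕ → Bool
inRow c (b , a) = not (c ≤ᵇ b) ∧ (c ≤ᵇ a)

inRow⇒ : ∀ c b a → T (inRow c (b , a)) → b < c × c ≤ a
inRow⇒ c b a t with c ≤ᵇ b in e
... | false = ≤ᵇ≡false⇒> e , ≤ᵇ⇒≤ c a t

disjoint-rows-share-no-column : ∀ c b₁ a₁ b₂ a₂ → T (inRow c (b₁ , a₁)) → T (inRow c (b₂ , a₂)) →
                                ¬ T (disjointI (b₁ , a₁) (b₂ , a₂))
disjoint-rows-share-no-column c b₁ a₁ b₂ a₂ in₁ in₂ d
  with inRow⇒ c b₁ a₁ in₁ | inRow⇒ c b₂ a₂ in₂
... | b₁<c , c≤a₁ | b₂<c , c≤a₂ with T-∨⁻ (a₁ ≤ᵇ b₁) d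
... | inj₁ t = <⇒≱ (≤-trans b₁<c c≤a₁) (≤ᵇ⇒≤ a₁ b₁ t)
... | inj₂ d′ with T-∨⁻ (a₂ ≤ᵇ b₂) d′
... | inj₁ t = <⇒≱ (≤-trans b₂<c c≤a₂) (≤ᵇ⇒≤ a₂ b₂ t)
... | inj₂ d″ with T-∨⁻ (a₁ ≤ᵇ b₂) d″
... | inj₁ t = <⇒≱ (≤-trans b₂<c c≤a₁) (≤ᵇ⇒≤ a₁ b₂ t)
... | inj₂ t = <⇒≱ (≤-trans b₁<c c≤a₂) (≤ᵇ⇒≤ a₂ b₁ t)

pairwiseDisj⇒column≤1 : ∀ c rows → T (pairwiseDisj rows) → countB (inRow c) rows ≤ 1
pairwiseDisj⇒column≤1 c [] _ = z≤n
pairwiseDisj⇒column≤1 c ((b , a) ∷ rows) t rewrite countB-∷ (inRow c) (b , a) rows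
  with inRow c (b , a) in e
... | true = ≤-reflexive (cong suc (countB-none (inRow c) rows λ { (b′ , a′) m i →
        disjoint-rows-share-no-column c b a b′ a′ (≡true⇒T e) i
          (allB⁻ (disjointI (b , a)) rows (T-∧⁻ˡ (allB (disjointI (b , a)) rows) t) m) }))
... | false = pairwiseDisj⇒column≤1 c rows (T-∧⁻ʳ (allB (disjointI (b , a)) rows) t)

count≥-Pointwise : ∀ c {t a} → Pointwise _≤_ t a → count≥ c a ≡ count≥ c t + countB (inRow c) (zip t a)
count≥-Pointwise c [] = refl
count≥-Pointwise c (_∷_ {x} {y} {xs} {ys} x≤y r)
  rewrite count≥-∷ c y ys | count≥-∷ c x xs | countB-∷ (inRow c) (x , y) (zip xs ys)
        | count≥-Pointwise c r with c ≤ᵇ x in e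
... | true rewrite T⇒≡true (≤⇒≤ᵇ (≤-trans (≤ᵇ⇒≤ c x (≡true⇒T e)) x≤y)) = refl
... | false = x∙yz≈y∙xz (indicator (c ≤ᵇ y)) (count≥ c xs) (countB (inRow c) (zip xs ys))

skewRows-⊑ : ∀ p a t → Pointwise _≤_ t a → skewRows (p ++ a) t ≡ map (0 ,_) p ++ zip t a
skewRows-⊑ p a t r rewrite length-++ p {a} | sym (Pointwise-length r) | m+n∸n≡m (length p) (length t) =
  zipPadded p
  where
  zipPadded : ∀ p → zip (replicate (length p) 0 ++ t) (p ++ a) ≡ map (0 ,_) p ++ zip t a
  zipPadded [] = refl
  zipPadded (x ∷ p) = cong ((0 , x) ∷_) (zipPadded p)

countB-inRow-fullRows : ∀ c p → countB (inRow (suc c)) (map (0 ,_) p) ≡ count≥ (suc c) p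
countB-inRow-fullRows c [] = refl
countB-inRow-fullRows c (x ∷ p) rewrite countB-∷ (inRow (suc c)) (0 , x) (map (0 ,_) p) | count≥-∷ (suc c) x p =
  cong (indicator (suc c ≤ᵇ x) +_) (countB-inRow-fullRows c p)

hcStrip⇒⊑ : ∀ β t → T (hcStripB β t) → t ⊑ β
hcStrip⇒⊑ β t h = leCB⇒⊑ t β (T-∧⁻ˡ (leCB t β) h)

hcStrip-column≤1 : ∀ β t → T (hcStripB β t) → ∀ c → countB (inRow c) (skewRows β t) ≤ 1
hcStrip-column≤1 β t h c = pairwiseDisj⇒column≤1 c (skewRows β t) (T-∧⁻ʳ (leCB t β) h)

skewColumn-⊑ : ∀ c p a t → Pointwise _≤_ t a →
               countB (inRow (suc c)) (skewRows (p ++ a) t) ≡ count≥ (suc c) p + countB (inRow (suc c)) (zip t a)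
skewColumn-⊑ c p a t r rewrite skewRows-⊑ p a t r
  | countB-++ (inRow (suc c)) (map (0 ,_) p) (zip t a) | countB-inRow-fullRows c p = refl

count≥-⊑ : ∀ c p a t → Pointwise _≤_ t a →
           count≥ (suc c) (p ++ a) ≡ countB (inRow (suc c)) (skewRows (p ++ a) t) + count≥ (suc c) t
count≥-⊑ c p a t r = begin
  count≥ (suc c) (p ++ a)                          ≡⟨ countB-++ (λ r → suc c ≤ᵇ r) p a ⟩
  count≥ (suc c) p + count≥ (suc c) a              ≡⟨ cong (count≥ (suc c) p +_) (count≥-Pointwise (suc c) r) ⟩
  count≥ (suc c) p + (count≥ (suc c) t + X)        ≡⟨ x∙yz≈y∙xz (count≥ (suc c) p) (count≥ (suc c) t) X ⟩
  count≥ (suc c) t + (count≥ (suc c) p + X)        ≡⟨ +-comm (count≥ (suc c) t) _ ⟩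
  count≥ (suc c) p + X + count≥ (suc c) t          ≡⟨ cong (_+ count≥ (suc c) t) (skewColumn-⊑ c p a t r) ⟨
  countB (inRow (suc c)) (skewRows (p ++ a) t) + count≥ (suc c) t  ∎
  where
  open ≡-Reasoning
  X = countB (inRow (suc c)) (zip t a)

-- for partitions: λ/μ is a horizontal strip and λ′/μ′ a vertical strip
record ColumnsInterlace (λ′ μ : List ℕ) : Set where
  field
    lower : ∀ c → count≥ (suc c) μ ≤ count≥ (suc c) λ′
    upper : ∀ c → count≥ (suc c) λ′ ≤ suc (count≥ (suc c) μ)

hcStrip-interlace : ∀ β t → T (hcStripB β t) → ColumnsInterlace β t
hcStrip-interlace β t h with hcStrip⇒⊑ β t h
... | p , a , refl , r = record
  { lower = λ c → subst (count≥ (suc c) t ≤_) (sym (count≥-⊑ c p a t r)) (m≤n+m _ _)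
  ; upper = λ c → subst (_≤ suc (count≥ (suc c) t)) (sym (count≥-⊑ c p a t r))
      (+-monoˡ-≤ (count≥ (suc c) t) (hcStrip-column≤1 _ t h (suc c)))
  }

hcStrip-decomposition : ∀ β t → IsComposition β → T (hcStripB β t) →
                        ∃ λ p → ∃ λ a → β ≡ p ++ a × Pointwise _≤_ t a × length p ≤ 1
hcStrip-decomposition β t cβ h with hcStrip⇒⊑ β t h
... | p , a , refl , r = p , a , refl , r , (begin
  length p                                                 ≡⟨ count≥1≡length p (All.++⁻ˡ p cβ) ⟨
  count≥ 1 p                                               ≤⟨ m≤m+n _ _ ⟩
  count≥ 1 p + countB (inRow 1) (zip t a)                  ≡⟨ skewColumn-⊑ 0 p a t r ⟨
  countB (inRow 1) (skewRows (p ++ a) t)                   ≤⟨ hcStrip-column≤1 _ t h 1 ⟩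
  1                                                        ∎)
  where open ≤-Reasoning

size-mono : ∀ {t a} → Pointwise _≤_ t a → size t ≤ size a
size-mono [] = z≤n
size-mono (x≤y ∷ r) = +-mono-≤ x≤y (size-mono r)

size-mono-≡⇒≡ : ∀ {t a} → Pointwise _≤_ t a → size t ≡ size a → t ≡ a
size-mono-≡⇒≡ [] _ = refl
size-mono-≡⇒≡ (_∷_ {x} {y} {xs} {ys} x≤y r) e = cong₂ _∷_ x≡y (size-mono-≡⇒≡ r (+-cancelˡ-≡ x _ _ e′))
  where
  x≡y : x ≡ y
  x≡y = ≤-antisym x≤y (+-cancelʳ-≤ (size ys) y x (subst (_≤ x + size ys) e (+-monoʳ-≤ x (size-mono r))))
  e′ : x + size xs ≡ x + size ys
  e′ = trans e (cong (_+ size ys) (sym x≡y))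

_◁_ : List ℕ → List ℕ → Set
β ◁ γ = length β < length γ ⊎ (length β ≡ length γ × nth β 0 < nth γ 0)

◁-induction : (P : List ℕ → Set) → (∀ γ → (∀ β → β ◁ γ → P β) → P γ) → ∀ γ → P γ
◁-induction P step γ = <-rec ByLength byLength (length γ) γ refl
  where
  ByLength : ℕ → Set
  ByLength n = ∀ γ → length γ ≡ n → P γ
  byLength : ∀ n → (∀ {m} → m < n → ByLength m) → ByLength n
  byLength n shorter γ len = <-rec ByHead byHead (nth γ 0) γ refl len
    where
    ByHead : ℕ → Set
    ByHead h = ∀ γ → nth γ 0 ≡ h → length γ ≡ n → P γ
    byHead : ∀ h → (∀ {m} → m < h → ByHead m) → ByHead h
    byHead h smaller γ refl len = step γ λ
      { β (inj₁ lt) → shorter (subst (length β <_) len lt) β refl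
      ; β (inj₂ (eq , lt)) → smaller lt β refl (trans eq len) }

hcStrip-◁ : ∀ g t β → IsComposition β → T (hcStripB β t) → size β ≡ g + size t → ¬ β ≡ g ∷ t → β ◁ (g ∷ t)
hcStrip-◁ g t β cβ h sβ β≢ with hcStrip-decomposition β t cβ h
... | [] , a , refl , r , _ = inj₁ (s≤s (≤-reflexive (sym (Pointwise-length r))))
... | _ ∷ _ ∷ _ , _ , _ , _ , s≤s ()
... | x ∷ [] , a , refl , r , _ = inj₂ (cong suc (sym (Pointwise-length r)) , x<g)
  where
  x≤g : x ≤ g
  x≤g = +-cancelʳ-≤ (size t) x g (≤-trans (+-monoʳ-≤ x (size-mono r)) (≤-reflexive sβ))
  x<g : x < g
  x<g with m≤n⇒m<n∨m≡n x≤g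
  ... | inj₁ lt = lt
  ... | inj₂ refl = ⊥-elim (β≢ (cong (x ∷_) (sym (size-mono-≡⇒≡ r (sym (+-cancelˡ-≡ x _ _ sβ))))))

head-hcStrip : ∀ g t → T (hcStripB (suc g ∷ t) t)
head-hcStrip g t = T-∧⁺ below rowsDisjoint
  where
  below : T (leCB t (suc g ∷ t))
  below rewrite +-comm (suc g) (size t) | m+n∸m≡n (size t) (suc g) =
    T-∧⁺ (≤⇒≤ᵇ (m≤m+n (size t) (suc g))) (∈⇒memL _ _ (head-cover g t))
  emptyRowʳ : ∀ row x → T (disjointI row (x , x))
  emptyRowʳ (b , a) x = T-∨⁺ʳ (a ≤ᵇ b) (T-∨⁺ˡ _ (≤ᵇ-refl x))
  emptyRowsʳ : ∀ row t → T (allB (disjointI row) (zip t t))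
  emptyRowsʳ row [] = tt
  emptyRowsʳ row (x ∷ t) = T-∧⁺ (emptyRowʳ row x) (emptyRowsʳ row t)
  emptyRows : ∀ t → T (pairwiseDisj (zip t t))
  emptyRows [] = tt
  emptyRows (x ∷ t) = T-∧⁺ (allB⁺ (disjointI (x , x)) (zip t t) (All.universal (λ _ → T-∨⁺ˡ _ (≤ᵇ-refl x)) _)) (emptyRows t)
  rowsDisjoint : T (pairwiseDisj (skewRows (suc g ∷ t) t))
  rowsDisjoint rewrite m+n∸n≡m 1 (length t) = T-∧⁺ (emptyRowsʳ (0 , suc g) t) (emptyRows t)

-- Sorting, partitions and conjugation

Sorted : List ℕ → Set
Sorted = Linked _≥_

count≥-insertDesc : ∀ c x ys → count≥ c (insertDesc x ys) ≡ count≥ c (x ∷ ys)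
count≥-insertDesc c x [] = refl
count≥-insertDesc c x (y ∷ ys) with y ≤ᵇ x
... | true = refl
... | false rewrite count≥-∷ c y (insertDesc x ys) | count≥-insertDesc c x ys
      | count≥-∷ c x ys | count≥-∷ c x (y ∷ ys) | count≥-∷ c y ys =
  x∙yz≈y∙xz (indicator (c ≤ᵇ y)) (indicator (c ≤ᵇ x)) (count≥ c ys)

count≥-sortDesc : ∀ c α → count≥ c (sortDesc α) ≡ count≥ c α
count≥-sortDesc c [] = refl
count≥-sortDesc c (x ∷ α) rewrite count≥-insertDesc c x (sortDesc α) | count≥-∷ c x (sortDesc α)
  | count≥-∷ c x α = cong (indicator (c ≤ᵇ x) +_) (count≥-sortDesc c α)

size-insertDesc : ∀ x ys → size (insertDesc x ys) ≡ x + size ys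
size-insertDesc x [] = refl
size-insertDesc x (y ∷ ys) with y ≤ᵇ x
... | true = refl
... | false rewrite size-insertDesc x ys = x∙yz≈y∙xz y x (size ys)

size-sortDesc : ∀ α → size (sortDesc α) ≡ size α
size-sortDesc [] = refl
size-sortDesc (x ∷ α) rewrite size-insertDesc x (sortDesc α) = cong (x +_) (size-sortDesc α)

All-insertDesc : ∀ {P : ℕ → Set} x ys → P x → All P ys → All P (insertDesc x ys)
All-insertDesc x [] px [] = px ∷ []
All-insertDesc x (y ∷ ys) px (py ∷ pys) with y ≤ᵇ x
... | true = px ∷ py ∷ pys
... | false = py ∷ All-insertDesc x ys px pys

All-sortDesc : ∀ {P : ℕ → Set} α → All P α → All P (sortDesc α)
All-sortDesc [] [] = []
All-sortDesc (x ∷ α) (px ∷ pα) = All-insertDesc x (sortDesc α) px (All-sortDesc α pα)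

insertDesc-sorted : ∀ x ys → Sorted ys → Sorted (insertDesc x ys)
insertDesc-sorted x [] _ = [-]
insertDesc-sorted x (y ∷ ys) s with y ≤ᵇ x in e
... | true = ≤ᵇ⇒≤ y x (≡true⇒T e) ∷ s
... | false = insertBelow y ys (<⇒≤ (≤ᵇ≡false⇒> e)) s
  where
  insertBelow : ∀ y ys → x ≤ y → Sorted (y ∷ ys) → Sorted (y ∷ insertDesc x ys)
  insertBelow y [] x≤y _ = x≤y ∷ [-]
  insertBelow y (z ∷ zs) x≤y (z≤y ∷ s) with z ≤ᵇ x in e
  ... | true = x≤y ∷ ≤ᵇ⇒≤ z x (≡true⇒T e) ∷ s
  ... | false = z≤y ∷ insertBelow z zs (<⇒≤ (≤ᵇ≡false⇒> e)) s

sortDesc-sorted : ∀ α → Sorted (sortDesc α)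
sortDesc-sorted [] = []
sortDesc-sorted (x ∷ α) = insertDesc-sorted x (sortDesc α) (sortDesc-sorted α)

sorted-composition⇒partition : ∀ λ′ → Sorted λ′ → IsComposition λ′ → T (isPartitionB λ′)
sorted-composition⇒partition [] _ _ = tt
sorted-composition⇒partition (x ∷ []) _ (1≤x ∷ _) = ≤⇒≤ᵇ 1≤x
sorted-composition⇒partition (x ∷ y ∷ ys) (y≤x ∷ s) (_ ∷ c) =
  T-∧⁺ (≤⇒≤ᵇ y≤x) (sorted-composition⇒partition (y ∷ ys) s c)

sorted-tail : ∀ {x xs} → Sorted (x ∷ xs) → Sorted xs
sorted-tail [-] = []
sorted-tail (_ ∷ s) = s

sorted-nth≤head : ∀ {x} xs i → Sorted (x ∷ xs) → nth xs i ≤ x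
sorted-nth≤head [] i _ = z≤n
sorted-nth≤head (y ∷ ys) zero (y≤x ∷ _) = y≤x
sorted-nth≤head (y ∷ ys) (suc i) (y≤x ∷ s) = ≤-trans (sorted-nth≤head ys i s) y≤x

count≥-head< : ∀ c x xs → Sorted (x ∷ xs) → x < c → count≥ c (x ∷ xs) ≡ 0
count≥-head< c x xs s x<c rewrite count≥-∷ c x xs | ¬T⇒≡false (λ t → <⇒≱ x<c (≤ᵇ⇒≤ c x t)) = tail xs s
  where
  tail : ∀ xs → Sorted (x ∷ xs) → count≥ c xs ≡ 0
  tail [] _ = refl
  tail (y ∷ ys) (y≤x ∷ s) = count≥-head< c y ys s (≤-<-trans y≤x x<c)

≤nth⇒<count≥ : ∀ c λ′ i → Sorted λ′ → 1 ≤ c → c ≤ nth λ′ i → i < count≥ c λ′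
≤nth⇒<count≥ c [] i _ 1≤c c≤0 = ⊥-elim (<⇒≱ 1≤c c≤0)
≤nth⇒<count≥ c (x ∷ xs) zero s _ c≤x rewrite count≥-∷ c x xs | T⇒≡true (≤⇒≤ᵇ c≤x) = s≤s z≤n
≤nth⇒<count≥ c (x ∷ xs) (suc i) s 1≤c c≤ rewrite count≥-∷ c x xs
  | T⇒≡true (≤⇒≤ᵇ (≤-trans c≤ (sorted-nth≤head xs i s))) = s≤s (≤nth⇒<count≥ c xs i (sorted-tail s) 1≤c c≤)

<count≥⇒≤nth : ∀ c λ′ i → Sorted λ′ → i < count≥ c λ′ → c ≤ nth λ′ i
<count≥⇒≤nth c (x ∷ xs) i s lt with c ≤ᵇ x in e
<count≥⇒≤nth c (x ∷ xs) zero s lt | true = ≤ᵇ⇒≤ c x (≡true⇒T e)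
<count≥⇒≤nth c (x ∷ xs) (suc i) s lt | true = <count≥⇒≤nth c xs i (sorted-tail s) (≤-pred lt)
... | false = ⊥-elim (n≮0 (subst (i <_) (count≥-head< c x xs s (≤ᵇ≡false⇒> e)) lt′))
  where
  lt′ : i < count≥ c (x ∷ xs)
  lt′ rewrite count≥-∷ c x xs | e = lt

module _ {λ′ μ : List ℕ} (sλ : Sorted λ′) (sμ : Sorted μ) (i : ColumnsInterlace λ′ μ) where
  open ColumnsInterlace i

  interlace-nth : ∀ j → nth μ j ≤ nth λ′ j
  interlace-nth j with nth μ j in e
  ... | zero = z≤n
  ... | suc c = <count≥⇒≤nth (suc c) λ′ j sλ
                  (≤-trans (≤nth⇒<count≥ (suc c) μ j sμ (s≤s z≤n) (≤-reflexive (sym e))) (lower c))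

  interlace-nth-suc : ∀ j → nth λ′ (suc j) ≤ nth μ j
  interlace-nth-suc j with nth λ′ (suc j) in e
  ... | zero = z≤n
  ... | suc c = <count≥⇒≤nth (suc c) μ j sμ
                  (≤-pred (≤-trans (≤nth⇒<count≥ (suc c) λ′ (suc j) sλ (s≤s z≤n) (≤-reflexive (sym e))) (upper c)))

  interlace-hStrip : IsComposition λ′ → IsComposition μ → T (hStripB λ′ μ)
  interlace-hStrip cλ cμ =
    T-∧⁺ (T-∧⁺ (≤⇒≤ᵇ (subst₂ _≤_ (count≥1≡length μ cμ) (count≥1≡length λ′ cλ) (lower 0)))
               (allB⁺ _ (upTo (length μ)) (All.universal (λ j → ≤⇒≤ᵇ (interlace-nth j)) _)))
         (allB⁺ _ (upTo (length λ′)) (All.universal (λ j → ≤⇒≤ᵇ (interlace-nth-suc j)) _))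

nth-applyUpTo : ∀ (f : ℕ → ℕ) n j → j < n → nth (applyUpTo f n) j ≡ f j
nth-applyUpTo f (suc n) zero _ = refl
nth-applyUpTo f (suc n) (suc j) lt = nth-applyUpTo (λ x → f (suc x)) n j (≤-pred lt)

nth-applyUpTo-≥ : ∀ (f : ℕ → ℕ) n j → n ≤ j → nth (applyUpTo f n) j ≡ 0
nth-applyUpTo-≥ f zero j _ = refl
nth-applyUpTo-≥ f (suc n) (suc j) le = nth-applyUpTo-≥ (λ x → f (suc x)) n j (≤-pred le)

conj≡applyUpTo : ∀ λ′ → conj λ′ ≡ applyUpTo (λ j → count≥ (suc j) λ′) (nth λ′ 0)
conj≡applyUpTo λ′ = map-upTo (λ j → count≥ (suc j) λ′) (nth λ′ 0)

nth-conj : ∀ λ′ j → Sorted λ′ → nth (conj λ′) j ≡ count≥ (suc j) λ′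
nth-conj λ′ j s rewrite conj≡applyUpTo λ′ with j <? nth λ′ 0
... | yes lt = nth-applyUpTo _ (nth λ′ 0) j lt
... | no ¬lt with count≥ (suc j) λ′ in e
...   | zero = nth-applyUpTo-≥ _ (nth λ′ 0) j (≮⇒≥ ¬lt)
...   | suc _ = ⊥-elim (¬lt (<count≥⇒≤nth (suc j) λ′ 0 s (subst (0 <_) (sym e) (s≤s z≤n))))

length-conj : ∀ λ′ → length (conj λ′) ≡ nth λ′ 0
length-conj λ′ = trans (length-map _ (upTo (nth λ′ 0))) (length-upTo (nth λ′ 0))

interlace-vStrip-conj : ∀ {λ′ μ} → Sorted λ′ → Sorted μ → ColumnsInterlace λ′ μ → T (vStripB (conj λ′) (conj μ))
interlace-vStrip-conj {λ′} {μ} sλ sμ i =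
  T-∧⁺ (T-∧⁺ (≤⇒≤ᵇ (subst₂ _≤_ (sym (length-conj μ)) (sym (length-conj λ′)) (interlace-nth sλ sμ i 0)))
             (allB⁺ _ (upTo (length (conj μ))) (All.universal
               (λ j → ≤⇒≤ᵇ (subst₂ _≤_ (sym (nth-conj μ j sμ)) (sym (nth-conj λ′ j sλ)) (lower j))) _)))
       (allB⁺ _ (upTo (length (conj λ′))) (All.universal
         (λ j → ≤⇒≤ᵇ (subst₂ _≤_ (sym (nth-conj λ′ j sλ)) (cong suc (sym (nth-conj μ j sμ))) (upper j))) _))
  where open ColumnsInterlace i

-- Shapes with all hooks at most k

applyUpTo-prefix : ∀ {A : Set} (f : ℕ → A) {m n} → m ≤ n → ∃ λ rest → applyUpTo f n ≡ applyUpTo f m ++ rest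
applyUpTo-prefix f {n = n} z≤n = applyUpTo f n , refl
applyUpTo-prefix f (s≤s m≤n) with applyUpTo-prefix (λ i → f (suc i)) m≤n
... | rest , e = rest , cong (f 0 ∷_) e

map-nth-upTo : ∀ α → map (nth α) (upTo (length α)) ≡ α
map-nth-upTo α = trans (map-upTo (nth α) (length α)) (applyUpTo-nth α)
  where
  applyUpTo-nth : ∀ α → applyUpTo (nth α) (length α) ≡ α
  applyUpTo-nth [] = refl
  applyUpTo-nth (x ∷ α) = cong (x ∷_) (applyUpTo-nth α)

nth≤size : ∀ α i → nth α i ≤ size α
nth≤size [] i = z≤n
nth≤size (x ∷ α) zero = m≤m+n x (size α)
nth≤size (x ∷ α) (suc i) = ≤-trans (nth≤size α i) (m≤n+m (size α) x)

length≤size : ∀ α → IsComposition α → length α ≤ size α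
length≤size [] _ = z≤n
length≤size (x ∷ α) (1≤x ∷ cα) = +-mono-≤ 1≤x (length≤size α cα)

nth-conj≤length : ∀ α j → nth (conj α) j ≤ length α
nth-conj≤length α j rewrite conj≡applyUpTo α with j <? nth α 0
... | yes lt rewrite nth-applyUpTo (λ j → count≥ (suc j) α) (nth α 0) j lt = countB≤length _ α
... | no ¬lt rewrite nth-applyUpTo-≥ (λ j → count≥ (suc j) α) (nth α 0) j (≮⇒≥ ¬lt) = z≤n

hook≤ : ∀ α i j → hook α i j ≤ nth α i + length α
hook≤ α i j = ≤-trans (m∸n≤m _ 1)
  (+-mono-≤ (m∸n≤m (nth α i) j) (≤-trans (m∸n≤m (nth (conj α) j) i) (nth-conj≤length α j)))

SmallHooks : ℕ → List ℕ → Set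
SmallHooks k α = ∀ i j → hook α i j ≤ k

smallHooks : ∀ k α → IsComposition α → size α + size α ≤ k → SmallHooks k α
smallHooks k α cα le i j = ≤-trans (hook≤ α i j) (≤-trans (+-mono-≤ (nth≤size α i) (length≤size α cα)) le)

pMap-small : ∀ k α → IsComposition α → SmallHooks k α → pMap k α ≡ α
pMap-small k α cα small = begin
  filterB (λ x → 1 ≤ᵇ x) (map (rowCount k α) (upTo (length α)))  ≡⟨ cong (filterB _) (map-cong rowFull (upTo (length α))) ⟩
  filterB (λ x → 1 ≤ᵇ x) (map (nth α) (upTo (length α)))          ≡⟨ cong (filterB _) (map-nth-upTo α) ⟩
  filterB (λ x → 1 ≤ᵇ x) α                                        ≡⟨ filterB-all _ α (All.map ≤⇒≤ᵇ cα) ⟩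
  α                                                               ∎
  where
  open ≡-Reasoning
  rowFull : ∀ i → rowCount k α i ≡ nth α i
  rowFull i = trans (countB-all _ (upTo (nth α i)) (All.universal (λ j → ≤⇒≤ᵇ (small i j)) _))
                    (length-upTo (nth α i))

isCore-small : ∀ k α → SmallHooks k α → T (isCoreB k α)
isCore-small k α small =
  allB⁺ _ (upTo (length α)) (All.universal (λ i →
    allB⁺ _ (upTo (nth α i)) (All.universal (λ j → hook≢suc (small i j)) _)) _)
  where
  hook≢suc : ∀ {h} → h ≤ k → T (not (h ≡ᵇ suc k))
  hook≢suc {h} h≤k with h ≡ᵇ suc k in e
  ... | true = ⊥-elim (1+n≰n (≤-trans (≤-reflexive (sym (≡ᵇ⇒≡ h (suc k) (≡true⇒T e)))) h≤k))
  ... | false = tt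

-- Every partition κ of size ≤ |λ| has small hooks, so p(κ) = κ: the search for c(λ) meets λ
-- among these before any larger partition, and λ is the only hit there.
cMap-small : ∀ k λ′ → Sorted λ′ → IsComposition λ′ → size λ′ + size λ′ ≤ k → cMap k λ′ ≡ λ′
cMap-small k λ′ sλ cλ le = begin
  findB IsCoreOf [] (concatMap partitionsOf (upTo N))                ≡⟨ cong (λ ns → findB IsCoreOf [] (concatMap partitionsOf ns)) split ⟩
  findB IsCoreOf [] (concatMap partitionsOf (upTo (suc s) ++ rest))  ≡⟨ cong (findB IsCoreOf []) (concatMap-++ partitionsOf (upTo (suc s)) rest) ⟩
  findB IsCoreOf [] (small ++ concatMap partitionsOf rest)           ≡⟨ findB-first IsCoreOf [] small _ λ′ λ′∈small λ′-isCoreOf unique ⟩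
  λ′                                                                 ∎
  where
  open ≡-Reasoning
  s = size λ′
  N = suc (suc s * suc s)
  IsCoreOf : List ℕ → Bool
  IsCoreOf κ = isCoreB k κ ∧ eqL (pMap k κ) λ′
  small = concatMap partitionsOf (upTo (suc s))
  prefix = applyUpTo-prefix (λ i → i) {suc s} {N} (s≤s (m≤n⇒m≤1+n (m≤m+n s (s * suc s))))
  rest = proj₁ prefix
  split = proj₂ prefix
  λ′∈small : λ′ ∈ small
  λ′∈small = ∈-concatMap⁺ partitionsOf (lose (∈-upTo⁺ (≤-refl {suc s}))
               (∈-filterB⁺ isPartitionB (comps s) (comps-complete λ′ cλ) (sorted-composition⇒partition λ′ sλ cλ)))
  λ′-isCoreOf : T (IsCoreOf λ′)
  λ′-isCoreOf rewrite pMap-small k λ′ cλ (smallHooks k λ′ cλ le) =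
    T-∧⁺ (isCore-small k λ′ (smallHooks k λ′ cλ le)) (eqL-refl λ′)
  unique : ∀ κ → κ ∈ small → T (IsCoreOf κ) → κ ≡ λ′
  unique κ m t with find (∈-concatMap⁻ partitionsOf {upTo (suc s)} m)
  ... | n , n∈ , κ∈ with comps-sound n κ (proj₁ (∈-filterB⁻ isPartitionB (comps n) κ∈))
  ... | cκ , refl = eqL⇒≡ κ λ′ (subst (λ ρ → T (eqL ρ λ′)) (pMap-small k κ cκ (smallHooks k κ cκ leκ)) (T-∧⁻ʳ (isCoreB k κ) t))
    where
    leκ : size κ + size κ ≤ k
    leκ = ≤-trans (+-mono-≤ (≤-pred (∈-upTo⁻ n∈)) (≤-pred (∈-upTo⁻ n∈))) le

conj-composition : ∀ λ′ → Sorted λ′ → IsComposition (conj λ′)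
conj-composition λ′ s rewrite conj≡applyUpTo λ′ = All.tabulate positive
  where
  positive : ∀ {c} → c ∈ applyUpTo (λ j → count≥ (suc j) λ′) (nth λ′ 0) → 1 ≤ c
  positive m with ∈-applyUpTo⁻ (λ j → count≥ (suc j) λ′) m
  ... | j , j< , refl = ≤nth⇒<count≥ (suc j) λ′ 0 s (s≤s z≤n) j<

omegaK-small : ∀ k λ′ → Sorted λ′ → IsComposition λ′ → size λ′ + size λ′ ≤ k → omegaK k λ′ ≡ conj λ′
omegaK-small k λ′ s cλ le rewrite cMap-small k λ′ s cλ le =
  pMap-small k (conj λ′) (conj-composition λ′ s) λ i j → ≤-trans (hook≤ (conj λ′) i j)
    (≤-trans (+-mono-≤ (≤-trans (nth-conj≤length λ′ i) (length≤size λ′ cλ))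
                       (≤-trans (≤-reflexive (length-conj λ′)) (nth≤size λ′ 0))) le)

KBounded-small : ∀ k α → size α ≤ k → KBounded k α
KBounded-small k [] _ = []
KBounded-small k (x ∷ α) le = ≤-trans (m≤m+n x (size α)) le ∷ KBounded-small k α (≤-trans (m≤n+m (size α) x) le)

kBoundedB-small : ∀ k α → size α ≤ k → T (kBoundedB k α)
kBoundedB-small k α le = allB⁺ _ α (All.map ≤⇒≤ᵇ (KBounded-small k α le))

interlace-sortDesc : ∀ β t → ColumnsInterlace β t → ColumnsInterlace (sortDesc β) (sortDesc t)
interlace-sortDesc β t i = record
  { lower = λ c → subst₂ _≤_ (sym (count≥-sortDesc (suc c) t)) (sym (count≥-sortDesc (suc c) β)) (lower c)
  ; upper = λ c → subst₂ _≤_ (sym (count≥-sortDesc (suc c) β)) (cong suc (sym (count≥-sortDesc (suc c) t))) (upper c)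
  }
  where open ColumnsInterlace i

hcStrip⇒hkStrip : ∀ k β t → IsComposition β → IsComposition t → size t ≤ size β → size β + size β ≤ k →
                  T (hcStripB β t) → T (hkStripB k (sortDesc β) (sortDesc t))
hcStrip⇒hkStrip k β t cβ ct st≤sβ le h =
  T-∧⁺ (kBoundedB-small k (sortDesc β) (subst (_≤ k) (sym (size-sortDesc β)) sβ≤k))
  (T-∧⁺ (kBoundedB-small k (sortDesc t) (subst (_≤ k) (sym (size-sortDesc t)) (≤-trans st≤sβ sβ≤k)))
  (T-∧⁺ (interlace-hStrip sβ′ st′ interlace (All-sortDesc β cβ) (All-sortDesc t ct))
        vStrip))
  where
  sβ≤k = m+n≤o⇒m≤o (size β) le
  sβ′ = sortDesc-sorted β
  st′ = sortDesc-sorted t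
  interlace = interlace-sortDesc β t (hcStrip-interlace β t h)
  small : ∀ α → IsComposition α → size α ≤ size β → omegaK k (sortDesc α) ≡ conj (sortDesc α)
  small α cα sα = omegaK-small k (sortDesc α) (sortDesc-sorted α) (All-sortDesc α cα)
    (subst (λ n → n + n ≤ k) (sym (size-sortDesc α)) (≤-trans (+-mono-≤ sα sα) le))
  vStrip : T (vStripB (omegaK k (sortDesc β)) (omegaK k (sortDesc t)))
  vStrip rewrite small β cβ ≤-refl | small t ct st≤sβ = interlace-vStrip-conj sβ′ st′ interlace

hkcStrips≡hcStrips : ∀ k t g → IsComposition t → (size t + g) + (size t + g) ≤ k → hkcStrips k t g ≡ hcStrips t g
hkcStrips≡hcStrips k t g ct le = filterB-cong _ _ (comps (size t + g)) agree
  where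
  agree : ∀ β → β ∈ comps (size t + g) → (kBoundedB k β ∧ hkcStripB k β t) ≡ hcStripB β t
  agree β m = begin
    kBoundedB k β ∧ hkcStripB k β t  ≡⟨ cong (_∧ hkcStripB k β t) (T⇒≡true (kBoundedB-small k β (m+n≤o⇒m≤o (size β) leβ))) ⟩
    hkcStripB k β t                  ≡⟨ ∧-implied (hcStripB β t) _ (hcStrip⇒hkStrip k β t cβ ct st≤sβ leβ) ⟩
    hcStripB β t                     ∎
    where
    open ≡-Reasoning
    cβ = proj₁ (comps-sound (size t + g) β m)
    sβ = proj₂ (comps-sound (size t + g) β m)
    leβ : size β + size β ≤ k
    leβ = subst (λ n → n + n ≤ k) (sym sβ) le
    st≤sβ : size t ≤ size β
    st≤sβ = subst (size t ≤_) (sym sβ) (m≤m+n (size t) g)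

-- Coefficients and the Pieri recursion

sumℚ : List ℚ → ℚ
sumℚ = foldr _+ℚ_ 0ℚ

coeff-++ : ∀ x y w → coeff (x ++ y) w ≡ coeff x w +ℚ coeff y w
coeff-++ [] y w = sym (ℚ.+-identityˡ (coeff y w))
coeff-++ ((q , v) ∷ x) y w with eqL v w
... | true = trans (cong (q +ℚ_) (coeff-++ x y w)) (sym (ℚ.+-assoc q (coeff x w) (coeff y w)))
... | false = coeff-++ x y w

coeff-sumN : ∀ xs w → coeff (sumN xs) w ≡ sumℚ (map (λ x → coeff x w) xs)
coeff-sumN [] w = refl
coeff-sumN (x ∷ xs) w = trans (coeff-++ x (concat xs) w) (cong (coeff x w +ℚ_) (coeff-sumN xs w))

coeff-H·-[] : ∀ i x → coeff (H i · x) [] ≡ 0ℚ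
coeff-H·-[] i [] = refl
coeff-H·-[] i (_ ∷ x) = coeff-H·-[] i x

coeff-H·-∷ : ∀ i x j w → coeff (H i · x) (j ∷ w) ≡ (if i ≡ᵇ j then coeff x w else 0ℚ)
coeff-H·-∷ i [] j w with i ≡ᵇ j
... | true = refl
... | false = refl
coeff-H·-∷ i ((q , u) ∷ x) j w with i ≡ᵇ j | coeff-H·-∷ i x j w
... | false | ih = ih
... | true | ih with eqL u w
...   | true = cong₂ _+ℚ_ (ℚ.*-identityˡ q) ih
...   | false = ih

H·-cong : ∀ i {x y} → x ≈ y → H i · x ≈ H i · y
H·-cong i {x} {y} e [] = trans (coeff-H·-[] i x) (sym (coeff-H·-[] i y))
H·-cong i {x} {y} e (j ∷ w) = begin
  coeff (H i · x) (j ∷ w)             ≡⟨ coeff-H·-∷ i x j w ⟩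
  (if i ≡ᵇ j then coeff x w else 0ℚ)  ≡⟨ cong (λ q → if i ≡ᵇ j then q else 0ℚ) (e w) ⟩
  (if i ≡ᵇ j then coeff y w else 0ℚ)  ≡⟨ coeff-H·-∷ i y j w ⟨
  coeff (H i · y) (j ∷ w)             ∎
  where open ≡-Reasoning

module _ {A : Set} (f h : A → ℚ) where

  sumℚ-mono-≤ : ∀ xs → (∀ x → x ∈ xs → f x ≤ℚ h x) → sumℚ (map f xs) ≤ℚ sumℚ (map h xs)
  sumℚ-mono-≤ [] _ = ℚ.≤-refl
  sumℚ-mono-≤ (x ∷ xs) le = ℚ.+-mono-≤ (le x (here refl)) (sumℚ-mono-≤ xs (λ y m → le y (there m)))

  sumℚ-mono-< : ∀ xs {y} → y ∈ xs → (∀ x → x ∈ xs → f x ≤ℚ h x) → f y <ℚ h y → sumℚ (map f xs) <ℚ sumℚ (map h xs)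
  sumℚ-mono-< (x ∷ xs) (here refl) le lt = ℚ.+-mono-<-≤ lt (sumℚ-mono-≤ xs (λ y m → le y (there m)))
  sumℚ-mono-< (x ∷ xs) (there m) le lt =
    ℚ.+-mono-≤-< (le x (here refl)) (sumℚ-mono-< xs m (λ y m′ → le y (there m′)) lt)

module _ {A : Set} (_≟ᴬ_ : DecidableEquality A) where

  sumℚ-single-< : ∀ (f h : A → ℚ) xs {y} → y ∈ xs → (∀ x → x ∈ xs → ¬ x ≡ y → f x ≡ h x) →
                  f y <ℚ h y → sumℚ (map f xs) <ℚ sumℚ (map h xs)
  sumℚ-single-< f h xs {y} y∈ others lt = sumℚ-mono-< f h xs y∈ le lt
    where
    le : ∀ x → x ∈ xs → f x ≤ℚ h x
    le x m with x ≟ᴬ y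
    ... | yes refl = ℚ.<⇒≤ lt
    ... | no x≢y = ℚ.≤-reflexive (others x m x≢y)

  -- compares the two sums instead of subtracting the common terms, so duplicates of y in xs do no harm
  sumℚ-cancel : ∀ (f h : A → ℚ) xs {y} → y ∈ xs → (∀ x → x ∈ xs → ¬ x ≡ y → f x ≡ h x) →
                sumℚ (map f xs) ≡ sumℚ (map h xs) → f y ≡ h y
  sumℚ-cancel f h xs {y} y∈ others sums with ℚ.<-cmp (f y) (h y)
  ... | tri≈ _ e _ = e
  ... | tri< lt _ _ = ⊥-elim (ℚ.<-irrefl sums (sumℚ-single-< f h xs y∈ others lt))
  ... | tri> _ _ gt = ⊥-elim (ℚ.<-irrefl (sym sums) (sumℚ-single-< h f xs y∈ (λ x m x≢y → sym (others x m x≢y)) gt))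

PieriRule : ℕ → (List ℕ → NSym) → Set
PieriRule n F = ∀ t g → IsComposition t → 1 ≤ g → size t + g ≤ n → H g · F t ≈ sumN (map F (hcStrips t g))

-- H_g F_t = F_(g t) + Σ F_β with β ◁ (g t), so the Pieri rule determines F_(g t) from smaller shapes
pieri-unique : ∀ n {F G} → F [] ≈ G [] → PieriRule n F → PieriRule n G →
               ∀ γ → IsComposition γ → size γ ≤ n → F γ ≈ G γ
pieri-unique n {F} {G} F∅≈G∅ pieriF pieriG = ◁-induction Agree step
  where
  Agree : List ℕ → Set
  Agree γ = IsComposition γ → size γ ≤ n → F γ ≈ G γ
  step : ∀ γ → (∀ β → β ◁ γ → Agree β) → Agree γ
  step [] _ _ _ = F∅≈G∅
  step (zero ∷ t) _ (() ∷ _) _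
  step (suc g ∷ t) below (1≤g ∷ ct) le w =
    sumℚ-cancel (≡-dec _≟_) (λ β → coeff (F β) w) (λ β → coeff (G β) w) strips γ∈strips others sums
    where
    open ≡-Reasoning
    γ = suc g ∷ t
    strips = hcStrips t (suc g)
    le′ : size t + suc g ≤ n
    le′ = subst (_≤ n) (+-comm (suc g) (size t)) le
    F≈G-at-t : F t ≈ G t
    F≈G-at-t = below t (inj₁ ≤-refl) ct (m+n≤o⇒n≤o (suc g) le)
    sums : sumℚ (map (λ β → coeff (F β) w) strips) ≡ sumℚ (map (λ β → coeff (G β) w) strips)
    sums = begin
      sumℚ (map (λ β → coeff (F β) w) strips)      ≡⟨ cong sumℚ (map-∘ strips) ⟩
      sumℚ (map (λ x → coeff x w) (map F strips))  ≡⟨ coeff-sumN (map F strips) w ⟨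
      coeff (sumN (map F strips)) w                ≡⟨ pieriF t (suc g) ct 1≤g le′ w ⟨
      coeff (H (suc g) · F t) w                    ≡⟨ H·-cong (suc g) {F t} {G t} F≈G-at-t w ⟩
      coeff (H (suc g) · G t) w                    ≡⟨ pieriG t (suc g) ct 1≤g le′ w ⟩
      coeff (sumN (map G strips)) w                ≡⟨ coeff-sumN (map G strips) w ⟩
      sumℚ (map (λ x → coeff x w) (map G strips))  ≡⟨ cong sumℚ (map-∘ strips) ⟨
      sumℚ (map (λ β → coeff (G β) w) strips)      ∎
    γ∈strips : γ ∈ strips
    γ∈strips = ∈-filterB⁺ _ (comps (size t + suc g))
      (subst (λ m → γ ∈ comps m) (+-comm (suc g) (size t)) (comps-complete γ (1≤g ∷ ct))) (head-hcStrip g t)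
    others : ∀ β → β ∈ strips → ¬ β ≡ γ → coeff (F β) w ≡ coeff (G β) w
    others β m β≢γ with ∈-filterB⁻ _ (comps (size t + suc g)) m
    ... | β∈ , h with comps-sound _ β β∈
    ... | cβ , sβ = below β (hcStrip-◁ (suc g) t β cβ h (trans sβ (+-comm (size t) (suc g))) β≢γ)
                      cβ (subst (_≤ n) (sym sβ) le′) w

ncSchur-pieri : ∀ n {S} → IsNCSchur S → PieriRule n S
ncSchur-pieri n (_ , _ , pieri) t g ct 1≤g _ = pieri t ct g 1≤g

ncAffineSchur-pieri : ∀ k n {S} → IsNCAffineSchur k S → n + n ≤ k → PieriRule n S
ncAffineSchur-pieri k n {S} (_ , _ , pieri) nn≤k t g ct 1≤g le =
  subst (λ strips → H g · S t ≈ sumN (map S strips)) (hkcStrips≡hcStrips k t g ct (≤-trans (+-mono-≤ le le) nn≤k))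
    (pieri t ct (KBounded-small k t (≤-trans (m≤m+n (size t) g) size≤k)) g 1≤g (≤-trans (m≤n+m g (size t)) size≤k))
  where
  size≤k : size t + g ≤ k
  size≤k = ≤-trans le (m+n≤o⇒m≤o n nn≤k)

mainTheorem4 : (S : List ℕ → NSym) → IsNCSchur S →
    (Sk : ℕ → List ℕ → NSym) → (∀ k → IsNCAffineSchur k (Sk k)) →
    ∀ α → IsComposition α → ∃ λ K → ∀ k → K ≤ k → Sk k α ≈ S α
mainTheorem4 S isSchur Sk isAffine α cα = size α + size α , λ k K≤k →
  pieri-unique (size α) (λ w → trans (proj₁ (proj₂ (isAffine k)) w) (sym (proj₁ (proj₂ isSchur) w)))
    (ncAffineSchur-pieri k (size α) (isAffine k) K≤k) (ncSchur-pieri (size α) isSchur) α cα ≤-refl
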